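{- There is an effective procedure assigning to every ordered tuple $\mathcal{V}=(v_1,\dots,v_m)$ of vectors in $\mathbb{Z}^{2n}$ that generates $\mathbb{Z}^{2n}$ as a $\mathbb{Z}$-module a symplectic basis $\mathrm{SympBas}(\mathcal{V})$ of $\mathbb{Z}^{2n}$ such that for every $P\in\mathrm{Sp}_{2n}(\mathbb{Z})$ we have $\mathrm{SympBas}(\mathcal{V}P)=\mathrm{SympBas}(\mathcal{V})P$.
   Context: Vectors in $\mathbb{Z}^{2n}$ are written as row vectors, and for a tuple $\mathcal{V}=(v_1,\dots,v_m)$ and a matrix $P$, $\mathcal{V}P=(v_1P,\dots,v_mP)$; similarly a basis $(w_1,\dots,w_{2n})$ is mapped to $(w_1P,\dots,w_{2n}P)$. Let $J_n=\begin{pmatrix}0&I_n\\-I_n&0\end{pmatrix}$, $\omega(x,y)=xJ_ny^{\mathsf{T}}$ the standard alternating pairing, and $\mathrm{Sp}_{2n}(\mathbb{Z})=\{Q\in\mathrm{GL}_{2n}(\mathbb{Z}):Q^{\mathsf{T}}J_nQ=J_n\}$. A symplectic basis of $\mathbb{Z}^{2n}$ is a $\mathbb{Z}$-basis $e_1,\dots,e_n,f_1,\dots,f_n$ with $\omega(e_i,f_j)=\delta_{ij}$ and $\omega(e_i,e_j)=\omega(f_i,f_j)=0$ for all $i,j$. -}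

module Defs where

open import Data.Nat using (ℕ; zero; suc)
open import Data.Integer using (ℤ; 0ℤ; 1ℤ; -1ℤ; _+_; _*_)
open import Data.Fin using (Fin; zero; suc; splitAt; _↑ˡ_; _↑ʳ_)
open import Data.Fin.Properties using () renaming (_≟_ to _≟ᶠ_)
open import Data.Sum using (inj₁; inj₂)
open import Data.Product using (Σ; _×_; ∃)
open import Relation.Nullary using (yes; no)
open import Relation.Binary.PropositionalEquality using (_≡_)

Vecℤ : ℕ → Set
Vecℤ k = Fin k → ℤ

Mat : ℕ → ℕ → Set
Mat k l = Fin k → Fin l → ℤ

∑ : ∀ k → (Fin k → ℤ) → ℤ
∑ zero    f = 0ℤ
∑ (suc k) f = f zero + ∑ k (λ i → f (suc i))

_≈ᵥ_ : ∀ {k} → Vecℤ k → Vecℤ k → Set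
x ≈ᵥ y = ∀ j → x j ≡ y j

_≈ₘ_ : ∀ {k l} → Mat k l → Mat k l → Set
A ≈ₘ B = ∀ i j → A i j ≡ B i j

_·ᵥ_ : ∀ {k l} → Vecℤ k → Mat k l → Vecℤ l
(v ·ᵥ P) j = ∑ _ (λ i → v i * P i j)

_·ₘ_ : ∀ {k l r} → Mat k l → Mat l r → Mat k r
(A ·ₘ B) i j = ∑ _ (λ t → A i t * B t j)

_ᵀ : ∀ {k l} → Mat k l → Mat l k
(A ᵀ) i j = A j i

I : ∀ k → Mat k k
I k i j with i ≟ᶠ j
... | yes _ = 1ℤ
... | no  _ = 0ℤ

-- J_n = [[0, I_n], [-I_n, 0]] on indices Fin (n + n)
J : ∀ n → Mat (n Data.Nat.+ n) (n Data.Nat.+ n)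
J n i j with splitAt n i | splitAt n j
... | inj₁ a | inj₂ b with a ≟ᶠ b
...   | yes _ = 1ℤ
...   | no  _ = 0ℤ
J n i j | inj₂ a | inj₁ b with a ≟ᶠ b
...   | yes _ = -1ℤ
...   | no  _ = 0ℤ
J n i j | inj₁ _ | inj₁ _ = 0ℤ
J n i j | inj₂ _ | inj₂ _ = 0ℤ

ω : ∀ n → Vecℤ (n Data.Nat.+ n) → Vecℤ (n Data.Nat.+ n) → ℤ
ω n x y = ∑ _ (λ j → (x ·ᵥ J n) j * y j)

IsGL : ∀ k → Mat k k → Set
IsGL k Q = Σ (Mat k k) λ R → ((Q ·ₘ R) ≈ₘ I k) × ((R ·ₘ Q) ≈ₘ I k)

IsSp : ∀ n → Mat (n Data.Nat.+ n) (n Data.Nat.+ n) → Set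
IsSp n Q = IsGL (n Data.Nat.+ n) Q × (((Q ᵀ) ·ₘ (J n ·ₘ Q)) ≈ₘ J n)

lincomb : ∀ {m k} → (Fin m → ℤ) → (Fin m → Vecℤ k) → Vecℤ k
lincomb c v j = ∑ _ (λ t → c t * v t j)

Generates : ∀ {m k} → (Fin m → Vecℤ k) → Set
Generates {m} {k} v = ∀ (x : Vecℤ k) → Σ (Fin m → ℤ) λ c → lincomb c v ≈ᵥ x

LinIndep : ∀ {m k} → (Fin m → Vecℤ k) → Set
LinIndep {m} {k} v = ∀ (c : Fin m → ℤ) → lincomb c v ≈ᵥ (λ _ → 0ℤ) → ∀ t → c t ≡ 0ℤ

IsBasis : ∀ {m k} → (Fin m → Vecℤ k) → Set
IsBasis v = Generates v × LinIndep v

-- ordered symplectic basis (e_1..e_n, f_1..f_n): e_i = b (i ↑ˡ n), f_i = b (n ↑ʳ i)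
δ : ∀ {n} → Fin n → Fin n → ℤ
δ = I _

IsSymplecticBasis : ∀ n → (Fin (n Data.Nat.+ n) → Vecℤ (n Data.Nat.+ n)) → Set
IsSymplecticBasis n b =
  IsBasis b
  × (∀ (i j : Fin n) → ω n (b (i ↑ˡ n)) (b (n ↑ʳ j)) ≡ δ i j)
  × (∀ (i j : Fin n) → ω n (b (i ↑ˡ n)) (b (j ↑ˡ n)) ≡ 0ℤ)
  × (∀ (i j : Fin n) → ω n (b (n ↑ʳ i)) (b (n ↑ʳ j)) ≡ 0ℤ)

_⋆_ : ∀ {m k} → (Fin m → Vecℤ k) → Mat k k → Fin m → Vecℤ k
(V ⋆ P) t = V t ·ᵥ P

{-# OPTIONS --safe #-}
module Submission where

-- Write 𝒱 as an m × 2n matrix V with Gram matrix G = V J Vᵀ. A pair (C , Y) of integer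
-- matrices with C G Cᵀ = J and Y C G = G yields the symplectic basis B = C V: its Gram
-- matrix is the invertible J, so B is independent, and cancelling Vᵀ (V has a left
-- inverse since 𝒱 generates) and J in Y C G = G gives Y B = V, so B spans. Such a pair exists (C a left inverse of V, Y = V),
-- and both conditions are decidable and mention V only through G, so the first pair in
-- an enumeration of all integer matrix pairs is an effective choice depending only on G.
-- For P ∈ Sp₂ₙ(ℤ) the Gram matrix of V P is V (P J Pᵀ) Vᵀ = G, so the same C is chosen,
-- and SympBas(𝒱P) = C V P = SympBas(𝒱) P.

open import Defs
open import Data.Nat using (ℕ; zero; suc; _+_; _<_)
open import Data.Nat.Properties using (+-identityʳ; +-suc; n<1+n; m<1+n⇒m<n∨m≡n; <-cmp)
open import Data.Integer as ℤ using (ℤ; 0ℤ; 1ℤ; -1ℤ; +_; -[1+_]; -_; _*_)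
import Data.Integer.Properties as ℤP
open import Data.Fin using (Fin; zero; suc; splitAt; _↑ˡ_; _↑ʳ_; punchIn)
open import Data.Fin.Properties
  using (all?; splitAt-↑ˡ; splitAt-↑ʳ; splitAt⁻¹-↑ˡ; splitAt⁻¹-↑ʳ; ↑ˡ-injective; ↑ʳ-injective; punchInᵢ≢i)
  renaming (_≟_ to _≟ᶠ_)
open import Data.Vec.Functional using (_∷_; head; tail)
open import Data.Vec.Functional.Relation.Binary.Pointwise using (Pointwise)
import Data.Vec.Functional.Relation.Binary.Pointwise.Properties as Pointwise
open import Data.Product using (Σ; ∃; _×_; _,_; proj₁; proj₂)
open import Data.Product.Relation.Binary.Pointwise.NonDependent using () renaming (Pointwise to ×-Pointwise)
open import Data.Sum using (_⊎_; inj₁; inj₂; [_,_])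
open import Function using (_∘_)
open import Relation.Binary.Bundles using (Setoid)
open import Relation.Binary.Definitions using (tri<; tri≈; tri>)
open import Relation.Binary.PropositionalEquality as ≡ using (_≡_; _≢_; refl; sym; trans; cong; subst)
import Relation.Binary.Reasoning.Setoid as SetoidReasoning
open import Relation.Nullary using (¬_; Dec; yes; no; contradiction)
open import Relation.Nullary.Decidable using (_×-dec_; map′)
import Algebra.Properties.Semiring.Sum as SemiringSum

module ℤSum = SemiringSum ℤP.+-*-semiring
open ℤSum using (sum)

∑≡sum : ∀ k (f : Fin k → ℤ) → ∑ k f ≡ sum f
∑≡sum zero    f = refl
∑≡sum (suc k) f = cong (ℤ._+_ (f zero)) (∑≡sum k (f ∘ suc))

∑-cong : ∀ k {f g : Fin k → ℤ} → (∀ i → f i ≡ g i) → ∑ k f ≡ ∑ k g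
∑-cong k {f} {g} f≗g = trans (∑≡sum k f) (trans (ℤSum.sum-cong-≗ f≗g) (sym (∑≡sum k g)))

∑-zero : ∀ k {f : Fin k → ℤ} → (∀ i → f i ≡ 0ℤ) → ∑ k f ≡ 0ℤ
∑-zero k f≗0 = trans (∑-cong k f≗0) (trans (∑≡sum k _) (ℤSum.sum-replicate-zero k))

∑-single : ∀ k (i : Fin k) (f : Fin k → ℤ) → (∀ j → j ≢ i → f j ≡ 0ℤ) → ∑ k f ≡ f i
∑-single (suc k) i f off = begin
  ∑ (suc k) f                  ≡⟨ ∑≡sum (suc k) f ⟩
  sum f                        ≡⟨ ℤSum.sum-remove {i = i} f ⟩
  f i ℤ.+ sum (f ∘ punchIn i)  ≡⟨ cong (ℤ._+_ (f i)) rest≡0 ⟩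
  f i ℤ.+ 0ℤ                   ≡⟨ ℤP.+-identityʳ (f i) ⟩
  f i                          ∎
  where
  open ≡.≡-Reasoning
  rest≡0 : sum (f ∘ punchIn i) ≡ 0ℤ
  rest≡0 = trans (sym (∑≡sum k _)) (∑-zero k (λ j → off (punchIn i j) (punchInᵢ≢i i j)))

*-distribˡ-∑ : ∀ k c (f : Fin k → ℤ) → c * ∑ k f ≡ ∑ k (λ i → c * f i)
*-distribˡ-∑ k c f =
  trans (cong (c *_) (∑≡sum k f)) (trans (ℤSum.*-distribˡ-sum c f) (sym (∑≡sum k _)))

*-distribʳ-∑ : ∀ k c (f : Fin k → ℤ) → ∑ k f * c ≡ ∑ k (λ i → f i * c)
*-distribʳ-∑ k c f =
  trans (cong (_* c) (∑≡sum k f)) (trans (ℤSum.*-distribʳ-sum c f) (sym (∑≡sum k _)))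

neg-distrib-∑ : ∀ k (f : Fin k → ℤ) → - ∑ k f ≡ ∑ k (λ i → - f i)
neg-distrib-∑ k f = trans (sym (ℤP.-1*i≡-i (∑ k f)))
  (trans (*-distribˡ-∑ k -1ℤ f) (∑-cong k (λ i → ℤP.-1*i≡-i (f i))))

∑-comm : ∀ k l (f : Fin k → Fin l → ℤ) →
  ∑ k (λ i → ∑ l (f i)) ≡ ∑ l (λ j → ∑ k (λ i → f i j))
∑-comm k l f = trans (∑∑≡sumsum k l f) (trans (ℤSum.∑-comm f) (sym (∑∑≡sumsum l k (λ j i → f i j))))
  where
  ∑∑≡sumsum : ∀ k l (f : Fin k → Fin l → ℤ) → ∑ k (λ i → ∑ l (f i)) ≡ sum (λ i → sum (f i))
  ∑∑≡sumsum k l f = trans (∑≡sum k _) (ℤSum.sum-cong-≗ (λ i → ∑≡sum l (f i)))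

I-diag : ∀ k (i : Fin k) → I k i i ≡ 1ℤ
I-diag k i with i ≟ᶠ i
... | yes _  = refl
... | no i≢i = contradiction refl i≢i

I-off : ∀ k {i j : Fin k} → i ≢ j → I k i j ≡ 0ℤ
I-off k {i} {j} i≢j with i ≟ᶠ j
... | yes i≡j = contradiction i≡j i≢j
... | no  _   = refl

I-sym : ∀ k (i j : Fin k) → I k i j ≡ I k j i
I-sym k i j with i ≟ᶠ j | j ≟ᶠ i
... | yes _   | yes _   = refl
... | no  _   | no  _   = refl
... | yes i≡j | no  j≢i = contradiction (sym i≡j) j≢i
... | no  i≢j | yes j≡i = contradiction (sym j≡i) i≢j

I-reindex : ∀ {k l} (f : Fin k → Fin l) → (∀ a b → f a ≡ f b → a ≡ b) →
            ∀ a b → I l (f a) (f b) ≡ I k a b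
I-reindex f f-injective a b with f a ≟ᶠ f b | a ≟ᶠ b
... | yes _     | yes _   = refl
... | no  _     | no  _   = refl
... | yes fa≡fb | no  a≢b = contradiction (f-injective a b fa≡fb) a≢b
... | no  fa≢fb | yes a≡b = contradiction (cong f a≡b) fa≢fb

≈ᵥ-setoid : ℕ → Setoid _ _
≈ᵥ-setoid = Pointwise.setoid (≡.setoid ℤ)

≈ₘ-setoid : ℕ → ℕ → Setoid _ _
≈ₘ-setoid k l = Pointwise.setoid (≈ᵥ-setoid l) k

module ≈ᵥ {k : ℕ} = Setoid (≈ᵥ-setoid k)
module ≈ₘ {k l : ℕ} = Setoid (≈ₘ-setoid k l)
module ≈ᵥ-Reasoning {k : ℕ} = SetoidReasoning (≈ᵥ-setoid k)
module ≈ₘ-Reasoning {k l : ℕ} = SetoidReasoning (≈ₘ-setoid k l)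

≈ₘ? : ∀ {k l} (A B : Mat k l) → Dec (A ≈ₘ B)
≈ₘ? A B = all? (λ i → all? (λ j → A i j ℤ.≟ B i j))

-ᵥ_ : ∀ {k} → Vecℤ k → Vecℤ k
(-ᵥ x) j = - x j

-ₘ_ : ∀ {k l} → Mat k l → Mat k l
(-ₘ A) i = -ᵥ A i

module _ {k l : ℕ} where

  ·ᵥ-congˡ : (x : Vecℤ k) {A B : Mat k l} → A ≈ₘ B → (x ·ᵥ A) ≈ᵥ (x ·ᵥ B)
  ·ᵥ-congˡ x A≈B j = ∑-cong k (λ i → cong (x i *_) (A≈B i j))

  ·ᵥ-congʳ : (A : Mat k l) {x y : Vecℤ k} → x ≈ᵥ y → (x ·ᵥ A) ≈ᵥ (y ·ᵥ A)
  ·ᵥ-congʳ A x≈y j = ∑-cong k (λ i → cong (_* A i j) (x≈y i))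

  ·ᵥ-zeroˡ : (A : Mat k l) → ((λ _ → 0ℤ) ·ᵥ A) ≈ᵥ (λ _ → 0ℤ)
  ·ᵥ-zeroˡ A j = ∑-zero k (λ i → ℤP.*-zeroˡ (A i j))

  neg-distribˡ-·ᵥ : (x : Vecℤ k) (A : Mat k l) → (-ᵥ (x ·ᵥ A)) ≈ᵥ ((-ᵥ x) ·ᵥ A)
  neg-distribˡ-·ᵥ x A j =
    trans (neg-distrib-∑ k _) (∑-cong k (λ i → ℤP.neg-distribˡ-* (x i) (A i j)))

  neg-distribʳ-·ᵥ : (x : Vecℤ k) (A : Mat k l) → (-ᵥ (x ·ᵥ A)) ≈ᵥ (x ·ᵥ (-ₘ A))
  neg-distribʳ-·ᵥ x A j =
    trans (neg-distrib-∑ k _) (∑-cong k (λ i → ℤP.neg-distribʳ-* (x i) (A i j)))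

  -ₘ-cong : {A B : Mat k l} → A ≈ₘ B → (-ₘ A) ≈ₘ (-ₘ B)
  -ₘ-cong A≈B i j = cong -_ (A≈B i j)

  -ₘ-involutive : (A : Mat k l) → (-ₘ (-ₘ A)) ≈ₘ A
  -ₘ-involutive A i j = ℤP.neg-involutive (A i j)

  ᵀ-cong : {A B : Mat k l} → A ≈ₘ B → (A ᵀ) ≈ₘ (B ᵀ)
  ᵀ-cong A≈B i j = A≈B j i

module _ {k l r : ℕ} where

  ·ₘ-congˡ : (A : Mat k l) {B B′ : Mat l r} → B ≈ₘ B′ → (A ·ₘ B) ≈ₘ (A ·ₘ B′)
  ·ₘ-congˡ A B≈B′ i = ·ᵥ-congˡ (A i) B≈B′

  ·ₘ-congʳ : (B : Mat l r) {A A′ : Mat k l} → A ≈ₘ A′ → (A ·ₘ B) ≈ₘ (A′ ·ₘ B)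
  ·ₘ-congʳ B A≈A′ i = ·ᵥ-congʳ B (A≈A′ i)

  ·ₘ-cong : {A A′ : Mat k l} {B B′ : Mat l r} → A ≈ₘ A′ → B ≈ₘ B′ → (A ·ₘ B) ≈ₘ (A′ ·ₘ B′)
  ·ₘ-cong {A′ = A′} {B = B} A≈A′ B≈B′ = ≈ₘ.trans (·ₘ-congʳ B A≈A′) (·ₘ-congˡ A′ B≈B′)

  neg-distribˡ-·ₘ : (A : Mat k l) (B : Mat l r) → (-ₘ (A ·ₘ B)) ≈ₘ ((-ₘ A) ·ₘ B)
  neg-distribˡ-·ₘ A B i = neg-distribˡ-·ᵥ (A i) B

  neg-distribʳ-·ₘ : (A : Mat k l) (B : Mat l r) → (-ₘ (A ·ₘ B)) ≈ₘ (A ·ₘ (-ₘ B))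
  neg-distribʳ-·ₘ A B i = neg-distribʳ-·ᵥ (A i) B

  ·ₘ-ᵀ : (A : Mat k l) (B : Mat l r) → ((A ·ₘ B) ᵀ) ≈ₘ ((B ᵀ) ·ₘ (A ᵀ))
  ·ₘ-ᵀ A B i j = ∑-cong l (λ t → ℤP.*-comm (A j t) (B t i))

·ᵥ-·ₘ-assoc : ∀ {k l r} (x : Vecℤ k) (A : Mat k l) (B : Mat l r) →
              ((x ·ᵥ A) ·ᵥ B) ≈ᵥ (x ·ᵥ (A ·ₘ B))
·ᵥ-·ₘ-assoc {k} {l} x A B j = begin
  ∑ l (λ t → ∑ k (λ i → x i * A i t) * B t j)    ≡⟨ ∑-cong l (λ t → *-distribʳ-∑ k (B t j) _) ⟩
  ∑ l (λ t → ∑ k (λ i → x i * A i t * B t j))    ≡⟨ ∑-comm l k _ ⟩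
  ∑ k (λ i → ∑ l (λ t → x i * A i t * B t j))    ≡⟨ ∑-cong k (λ i → ∑-cong l (λ t → ℤP.*-assoc (x i) _ _)) ⟩
  ∑ k (λ i → ∑ l (λ t → x i * (A i t * B t j)))  ≡⟨ ∑-cong k (λ i → *-distribˡ-∑ l (x i) _) ⟨
  ∑ k (λ i → x i * ∑ l (λ t → A i t * B t j))    ∎
  where open ≡.≡-Reasoning

·ₘ-assoc : ∀ {k l r s} (A : Mat k l) (B : Mat l r) (C : Mat r s) →
           ((A ·ₘ B) ·ₘ C) ≈ₘ (A ·ₘ (B ·ₘ C))
·ₘ-assoc A B C i = ·ᵥ-·ₘ-assoc (A i) B C

·ᵥ-identityʳ : ∀ {k} (x : Vecℤ k) → (x ·ᵥ I k) ≈ᵥ x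
·ᵥ-identityʳ {k} x j = trans
  (∑-single k j _ (λ i i≢j → trans (cong (x i *_) (I-off k i≢j)) (ℤP.*-zeroʳ (x i))))
  (trans (cong (x j *_) (I-diag k j)) (ℤP.*-identityʳ (x j)))

I-row-·ᵥ : ∀ {k l} (i : Fin k) (A : Mat k l) → (I k i ·ᵥ A) ≈ᵥ A i
I-row-·ᵥ {k} i A j = trans
  (∑-single k i _ (λ t t≢i → cong (_* A t j) (I-off k (t≢i ∘ sym))))
  (trans (cong (_* A i j) (I-diag k i)) (ℤP.*-identityˡ (A i j)))

·ₘ-identityˡ : ∀ {k l} (A : Mat k l) → (I k ·ₘ A) ≈ₘ A
·ₘ-identityˡ A i = I-row-·ᵥ i A

·ₘ-identityʳ : ∀ {k l} (A : Mat k l) → (A ·ₘ I l) ≈ₘ A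
·ₘ-identityʳ A i = ·ᵥ-identityʳ (A i)

Iᵀ : ∀ k → (I k ᵀ) ≈ₘ I k
Iᵀ k i j = I-sym k j i

·ᵥ-cancelʳ : ∀ {k l} {A : Mat k l} (A′ : Mat l k) → (A ·ₘ A′) ≈ₘ I k →
             {x y : Vecℤ k} → (x ·ᵥ A) ≈ᵥ (y ·ᵥ A) → x ≈ᵥ y
·ᵥ-cancelʳ {k} {A = A} A′ AA′≈I {x} {y} xA≈yA = begin
  x               ≈⟨ ·ᵥ-identityʳ x ⟨
  x ·ᵥ I k        ≈⟨ ·ᵥ-congˡ x AA′≈I ⟨
  x ·ᵥ (A ·ₘ A′)  ≈⟨ ·ᵥ-·ₘ-assoc x A A′ ⟨
  (x ·ᵥ A) ·ᵥ A′  ≈⟨ ·ᵥ-congʳ A′ xA≈yA ⟩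
  (y ·ᵥ A) ·ᵥ A′  ≈⟨ ·ᵥ-·ₘ-assoc y A A′ ⟩
  y ·ᵥ (A ·ₘ A′)  ≈⟨ ·ᵥ-congˡ y AA′≈I ⟩
  y ·ᵥ I k        ≈⟨ ·ᵥ-identityʳ y ⟩
  y               ∎
  where open ≈ᵥ-Reasoning

·ₘ-cancelʳ : ∀ {k l r} {A : Mat k l} (A′ : Mat l k) → (A ·ₘ A′) ≈ₘ I k →
             {X Y : Mat r k} → (X ·ₘ A) ≈ₘ (Y ·ₘ A) → X ≈ₘ Y
·ₘ-cancelʳ A′ AA′≈I XA≈YA i = ·ᵥ-cancelʳ A′ AA′≈I (XA≈YA i)

Pᵀ·A·P≈A⇒P·K·Pᵀ≈K : ∀ {k} {A K P R : Mat k k} →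
  (A ·ₘ K) ≈ₘ I k → (K ·ₘ A) ≈ₘ I k → (P ·ₘ R) ≈ₘ I k →
  ((P ᵀ) ·ₘ (A ·ₘ P)) ≈ₘ A → ((P ·ₘ K) ·ₘ (P ᵀ)) ≈ₘ K
Pᵀ·A·P≈A⇒P·K·Pᵀ≈K {k} {A} {K} {P} {R} AK≈I KA≈I PR≈I PᵀAP≈A =
  ·ₘ-cancelʳ K AK≈I (≈ₘ.trans XA≈I (≈ₘ.sym KA≈I))
  where
  open ≈ₘ-Reasoning
  X = (P ·ₘ K) ·ₘ (P ᵀ)
  XAP≈P : (X ·ₘ (A ·ₘ P)) ≈ₘ P
  XAP≈P = begin
    X ·ₘ (A ·ₘ P)                    ≈⟨ ·ₘ-assoc (P ·ₘ K) (P ᵀ) (A ·ₘ P) ⟩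
    (P ·ₘ K) ·ₘ ((P ᵀ) ·ₘ (A ·ₘ P))  ≈⟨ ·ₘ-congˡ (P ·ₘ K) PᵀAP≈A ⟩
    (P ·ₘ K) ·ₘ A                    ≈⟨ ·ₘ-assoc P K A ⟩
    P ·ₘ (K ·ₘ A)                    ≈⟨ ·ₘ-congˡ P KA≈I ⟩
    P ·ₘ I k                         ≈⟨ ·ₘ-identityʳ P ⟩
    P                                ∎
  XA≈I : (X ·ₘ A) ≈ₘ I k
  XA≈I = begin
    X ·ₘ A                ≈⟨ ·ₘ-identityʳ (X ·ₘ A) ⟨
    (X ·ₘ A) ·ₘ I k       ≈⟨ ·ₘ-congˡ (X ·ₘ A) PR≈I ⟨
    (X ·ₘ A) ·ₘ (P ·ₘ R)  ≈⟨ ·ₘ-assoc (X ·ₘ A) P R ⟨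
    ((X ·ₘ A) ·ₘ P) ·ₘ R  ≈⟨ ·ₘ-congʳ R (·ₘ-assoc X A P) ⟩
    (X ·ₘ (A ·ₘ P)) ·ₘ R  ≈⟨ ·ₘ-congʳ R XAP≈P ⟩
    P ·ₘ R                ≈⟨ PR≈I ⟩
    I k                   ∎

-- Gram matrices

gram : ∀ {k l} → Mat l l → Mat k l → Mat k k
gram X V = (V ·ₘ X) ·ₘ (V ᵀ)

gram-cong : ∀ {k l} {X X′ : Mat l l} {V V′ : Mat k l} →
            X ≈ₘ X′ → V ≈ₘ V′ → gram X V ≈ₘ gram X′ V′
gram-cong X≈X′ V≈V′ = ·ₘ-cong (·ₘ-cong V≈V′ X≈X′) (ᵀ-cong V≈V′)

gram-identity : ∀ {l} (X : Mat l l) → gram X (I l) ≈ₘ X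
gram-identity {l} X = ≈ₘ.trans (·ₘ-cong (·ₘ-identityˡ X) (Iᵀ l)) (·ₘ-identityʳ X)

gram-·ₘ : ∀ {k r l} (X : Mat l l) (C : Mat k r) (V : Mat r l) →
          gram X (C ·ₘ V) ≈ₘ gram (gram X V) C
gram-·ₘ X C V = begin
  ((C ·ₘ V) ·ₘ X) ·ₘ ((C ·ₘ V) ᵀ)      ≈⟨ ·ₘ-congˡ ((C ·ₘ V) ·ₘ X) (·ₘ-ᵀ C V) ⟩
  ((C ·ₘ V) ·ₘ X) ·ₘ ((V ᵀ) ·ₘ (C ᵀ))  ≈⟨ ·ₘ-assoc ((C ·ₘ V) ·ₘ X) (V ᵀ) (C ᵀ) ⟨
  (((C ·ₘ V) ·ₘ X) ·ₘ (V ᵀ)) ·ₘ (C ᵀ)  ≈⟨ ·ₘ-congʳ (C ᵀ) (·ₘ-congʳ (V ᵀ) (·ₘ-assoc C V X)) ⟩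
  ((C ·ₘ (V ·ₘ X)) ·ₘ (V ᵀ)) ·ₘ (C ᵀ)  ≈⟨ ·ₘ-congʳ (C ᵀ) (·ₘ-assoc C (V ·ₘ X) (V ᵀ)) ⟩
  (C ·ₘ gram X V) ·ₘ (C ᵀ)             ∎
  where open ≈ₘ-Reasoning

LinIndep-of-gram : ∀ {l} {X : Mat l l} (X′ : Mat l l) → (X ·ₘ X′) ≈ₘ I l →
                   {B : Mat l l} → gram X B ≈ₘ X → LinIndep B
LinIndep-of-gram {X = X} X′ XX′≈I {B} gram≈X c cB≈0 = ·ᵥ-cancelʳ X′ XX′≈I cX≈0X
  where
  open ≈ᵥ-Reasoning
  cX≈0X : (c ·ᵥ X) ≈ᵥ ((λ _ → 0ℤ) ·ᵥ X)
  cX≈0X = begin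
    c ·ᵥ X                      ≈⟨ ·ᵥ-congˡ c gram≈X ⟨
    c ·ᵥ gram X B               ≈⟨ ·ᵥ-·ₘ-assoc c (B ·ₘ X) (B ᵀ) ⟨
    (c ·ᵥ (B ·ₘ X)) ·ᵥ (B ᵀ)    ≈⟨ ·ᵥ-congʳ (B ᵀ) (·ᵥ-·ₘ-assoc c B X) ⟨
    ((c ·ᵥ B) ·ᵥ X) ·ᵥ (B ᵀ)    ≈⟨ ·ᵥ-congʳ (B ᵀ) (·ᵥ-congʳ X cB≈0) ⟩
    ((λ _ → 0ℤ) ·ᵥ X) ·ᵥ (B ᵀ)  ≈⟨ ·ᵥ-congʳ (B ᵀ) (·ᵥ-zeroˡ X) ⟩
    (λ _ → 0ℤ) ·ᵥ (B ᵀ)         ≈⟨ ·ᵥ-zeroˡ (B ᵀ) ⟩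
    (λ _ → 0ℤ)                  ≈⟨ ·ᵥ-zeroˡ X ⟨
    (λ _ → 0ℤ) ·ᵥ X             ∎

Generates-of-factor : ∀ {m k l} {V : Mat m l} {B : Mat k l} (Y : Mat m k) →
                      (Y ·ₘ B) ≈ₘ V → Generates V → Generates B
Generates-of-factor {B = B} Y YB≈V generates x =
  (c ·ᵥ Y) , ≈ᵥ.trans (·ᵥ-·ₘ-assoc c Y B) (≈ᵥ.trans (·ᵥ-congˡ c YB≈V) cV≈x)
  where
  c = proj₁ (generates x)
  cV≈x = proj₂ (generates x)

left-inverse : ∀ {m l} {V : Mat m l} → Generates V → Σ (Mat l m) λ E → (E ·ₘ V) ≈ₘ I l
left-inverse generates = (λ i → proj₁ (generates (I _ i))) , (λ i → proj₂ (generates (I _ i)))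

-- The standard symplectic form

data Half (n : ℕ) : Fin (n + n) → Set where
  first  : (a : Fin n) → Half n (a ↑ˡ n)
  second : (a : Fin n) → Half n (n ↑ʳ a)

half : ∀ n i → Half n i
half n i with splitAt n i in eq
... | inj₁ a = subst (Half n) (splitAt⁻¹-↑ˡ eq) (first a)
... | inj₂ a = subst (Half n) (splitAt⁻¹-↑ʳ eq) (second a)

↑ˡ≢↑ʳ : ∀ n (a b : Fin n) → a ↑ˡ n ≢ n ↑ʳ b
↑ˡ≢↑ʳ n a b eq with trans (sym (splitAt-↑ˡ n a n)) (trans (cong (splitAt n) eq) (splitAt-↑ʳ n n b))
... | ()

module _ (n : ℕ) where

  J-↑ˡ-↑ʳ : ∀ a b → J n (a ↑ˡ n) (n ↑ʳ b) ≡ I n a b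
  J-↑ˡ-↑ʳ a b rewrite splitAt-↑ˡ n a n | splitAt-↑ʳ n n b with a ≟ᶠ b
  ... | yes _ = refl
  ... | no  _ = refl

  J-↑ʳ-↑ˡ : ∀ a b → J n (n ↑ʳ a) (b ↑ˡ n) ≡ - I n a b
  J-↑ʳ-↑ˡ a b rewrite splitAt-↑ˡ n b n | splitAt-↑ʳ n n a with a ≟ᶠ b
  ... | yes _ = refl
  ... | no  _ = refl

  J-↑ˡ-↑ˡ : ∀ a b → J n (a ↑ˡ n) (b ↑ˡ n) ≡ 0ℤ
  J-↑ˡ-↑ˡ a b rewrite splitAt-↑ˡ n a n | splitAt-↑ˡ n b n = refl

  J-↑ʳ-↑ʳ : ∀ a b → J n (n ↑ʳ a) (n ↑ʳ b) ≡ 0ℤ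
  J-↑ʳ-↑ʳ a b rewrite splitAt-↑ʳ n n a | splitAt-↑ʳ n n b = refl

  J-row-↑ˡ : ∀ a → J n (a ↑ˡ n) ≈ᵥ I (n + n) (n ↑ʳ a)
  J-row-↑ˡ a j with half n j
  ... | first b  = trans (J-↑ˡ-↑ˡ a b) (sym (I-off (n + n) (↑ˡ≢↑ʳ n b a ∘ sym)))
  ... | second b = trans (J-↑ˡ-↑ʳ a b) (sym (I-reindex (n ↑ʳ_) (↑ʳ-injective n) a b))

  J-row-↑ʳ : ∀ a → J n (n ↑ʳ a) ≈ᵥ (-ᵥ I (n + n) (a ↑ˡ n))
  J-row-↑ʳ a j with half n j
  ... | first b  = trans (J-↑ʳ-↑ˡ a b) (cong -_ (sym (I-reindex (_↑ˡ n) (λ a b → ↑ˡ-injective n a b) a b)))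
  ... | second b = trans (J-↑ʳ-↑ʳ a b) (cong -_ (sym (I-off (n + n) (↑ˡ≢↑ʳ n a b))))

  J·J≈-I : (J n ·ₘ J n) ≈ₘ (-ₘ I (n + n))
  J·J≈-I i with half n i
  ... | first a = begin
    J n (a ↑ˡ n) ·ᵥ J n        ≈⟨ ·ᵥ-congʳ (J n) (J-row-↑ˡ a) ⟩
    I (n + n) (n ↑ʳ a) ·ᵥ J n  ≈⟨ I-row-·ᵥ (n ↑ʳ a) (J n) ⟩
    J n (n ↑ʳ a)               ≈⟨ J-row-↑ʳ a ⟩
    -ᵥ I (n + n) (a ↑ˡ n)      ∎
    where open ≈ᵥ-Reasoning
  ... | second a = begin
    J n (n ↑ʳ a) ·ᵥ J n             ≈⟨ ·ᵥ-congʳ (J n) (J-row-↑ʳ a) ⟩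
    (-ᵥ I (n + n) (a ↑ˡ n)) ·ᵥ J n  ≈⟨ neg-distribˡ-·ᵥ (I (n + n) (a ↑ˡ n)) (J n) ⟨
    -ᵥ (I (n + n) (a ↑ˡ n) ·ᵥ J n)  ≈⟨ cong -_ ∘ I-row-·ᵥ (a ↑ˡ n) (J n) ⟩
    -ᵥ J n (a ↑ˡ n)                 ≈⟨ cong -_ ∘ J-row-↑ˡ a ⟩
    -ᵥ I (n + n) (n ↑ʳ a)           ∎
    where open ≈ᵥ-Reasoning

  J⁻¹ : Mat (n + n) (n + n)
  J⁻¹ = -ₘ J n

  J·J⁻¹ : (J n ·ₘ J⁻¹) ≈ₘ I (n + n)
  J·J⁻¹ = ≈ₘ.trans (≈ₘ.sym (neg-distribʳ-·ₘ (J n) (J n)))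
            (≈ₘ.trans (-ₘ-cong J·J≈-I) (-ₘ-involutive (I (n + n))))

  J⁻¹·J : (J⁻¹ ·ₘ J n) ≈ₘ I (n + n)
  J⁻¹·J = ≈ₘ.trans (≈ₘ.sym (neg-distribˡ-·ₘ (J n) (J n)))
            (≈ₘ.trans (-ₘ-cong J·J≈-I) (-ₘ-involutive (I (n + n))))

IsSp⇒P·J·Pᵀ≈J : ∀ {n} {P : Mat (n + n) (n + n)} → IsSp n P → gram (J n) P ≈ₘ J n
IsSp⇒P·J·Pᵀ≈J {n} {P} ((R , PR≈I , _) , PᵀJP≈J) = begin
  (P ·ₘ J n) ·ₘ (P ᵀ)            ≈⟨ -ₘ-involutive _ ⟨
  -ₘ (-ₘ ((P ·ₘ J n) ·ₘ (P ᵀ)))  ≈⟨ -ₘ-cong -P·J·Pᵀ≈P·J⁻¹·Pᵀ ⟩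
  -ₘ ((P ·ₘ J⁻¹ n) ·ₘ (P ᵀ))     ≈⟨ -ₘ-cong (Pᵀ·A·P≈A⇒P·K·Pᵀ≈K (J·J⁻¹ n) (J⁻¹·J n) PR≈I PᵀJP≈J) ⟩
  -ₘ J⁻¹ n                       ≈⟨ -ₘ-involutive (J n) ⟩
  J n                            ∎
  where
  open ≈ₘ-Reasoning
  -P·J·Pᵀ≈P·J⁻¹·Pᵀ : (-ₘ ((P ·ₘ J n) ·ₘ (P ᵀ))) ≈ₘ ((P ·ₘ J⁻¹ n) ·ₘ (P ᵀ))
  -P·J·Pᵀ≈P·J⁻¹·Pᵀ = ≈ₘ.trans (neg-distribˡ-·ₘ (P ·ₘ J n) (P ᵀ))
                                (·ₘ-congʳ (P ᵀ) (neg-distribʳ-·ₘ P (J n)))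

gram-J-⋆ : ∀ {n m} (V : Mat m (n + n)) (P : Mat (n + n) (n + n)) → IsSp n P →
           gram (J n) (V ⋆ P) ≈ₘ gram (J n) V
gram-J-⋆ {n} V P sp = ≈ₘ.trans (gram-·ₘ (J n) V P) (gram-cong (IsSp⇒P·J·Pᵀ≈J {n} sp) ≈ₘ.refl)

-- Enumerations and least witnesses

record Enumeration (A : Set) (_∼_ : A → A → Set) : Set where
  field
    enum       : ℕ → A
    surjective : ∀ a → ∃ λ k → enum k ∼ a

open Enumeration

next : ℕ × ℕ → ℕ × ℕ
next (zero  , b) = suc b , zero
next (suc a , b) = a , suc b

-- Cantor's enumeration: the pairs with a + b = s are listed from (s , 0) to (0 , s).
unpair : ℕ → ℕ × ℕ
unpair zero    = zero , zero
unpair (suc k) = next (unpair k)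

unpair-along : ∀ a b → (∃ λ k → unpair k ≡ (a + b , 0)) → ∃ λ k → unpair k ≡ (a , b)
unpair-along a zero    (k , eq) = k , trans eq (cong (_, 0) (+-identityʳ a))
unpair-along a (suc b) (k , eq) with unpair-along (suc a) b (k , trans eq (cong (_, 0) (+-suc a b)))
... | k′ , eq′ = suc k′ , cong next eq′

unpair-start : ∀ s → ∃ λ k → unpair k ≡ (s , 0)
unpair-start zero    = zero , refl
unpair-start (suc s) with unpair-along 0 s (unpair-start s)
... | k , eq = suc k , cong next eq

ℕ×ℕ-enumeration : Enumeration (ℕ × ℕ) _≡_
ℕ×ℕ-enumeration = record
  { enum       = unpair
  ; surjective = λ (a , b) → unpair-along a b (unpair-start (a + b))
  }

ℤ-enumeration : Enumeration ℤ _≡_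
ℤ-enumeration = record { enum = signed ∘ unpair ; surjective = surj }
  where
  signed : ℕ × ℕ → ℤ
  signed (a , zero)  = + a
  signed (_ , suc b) = -[1+ b ]
  surj : ∀ z → ∃ λ k → signed (unpair k) ≡ z
  surj (+ a) with surjective ℕ×ℕ-enumeration (a , 0)
  ... | k , eq = k , cong signed eq
  surj -[1+ b ] with surjective ℕ×ℕ-enumeration (0 , suc b)
  ... | k , eq = k , cong signed eq

×-enumeration : ∀ {A B R S} → Enumeration A R → Enumeration B S → Enumeration (A × B) (×-Pointwise R S)
×-enumeration {R = R} {S} eA eB = record { enum = pick ∘ unpair ; surjective = surj }
  where
  pick : ℕ × ℕ → _
  pick (i , j) = enum eA i , enum eB j
  surj : ∀ p → ∃ λ k → ×-Pointwise R S (pick (unpair k)) p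
  surj (a , b) with surjective eA a | surjective eB b
  ... | i , ra | j , sb with surjective ℕ×ℕ-enumeration (i , j)
  ...   | k , eq = k , subst (λ p → ×-Pointwise R S (pick p) (a , b)) (sym eq) (ra , sb)

vector-enumeration : ∀ {A R} → Enumeration A R → ∀ k → Enumeration (Fin k → A) (Pointwise R)
vector-enumeration e zero    = record { enum = λ _ () ; surjective = λ _ → zero , λ () }
vector-enumeration {R = R} e (suc k) = record { enum = enum∷ ; surjective = surj }
  where
  e× = ×-enumeration e (vector-enumeration e k)
  enum∷ : ℕ → _
  enum∷ m = proj₁ (enum e× m) ∷ proj₂ (enum e× m)
  surj : ∀ f → ∃ λ m → Pointwise R (enum∷ m) f
  surj f with surjective e× (head f , tail f)
  ... | m , r-head , r-tail = m , λ { zero → r-head ; (suc i) → r-tail i }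

matrix-enumeration : ∀ k l → Enumeration (Mat k l) _≈ₘ_
matrix-enumeration k l = vector-enumeration (vector-enumeration ℤ-enumeration l) k

record Least (P : ℕ → Set) : Set where
  field
    index : ℕ
    holds : P index
    below : ∀ i → i < index → ¬ P i

open Least

module _ {P : ℕ → Set} (P? : ∀ i → Dec (P i)) where

  least-below : ∀ b → Least P ⊎ (∀ i → i < b → ¬ P i)
  least-below zero = inj₂ (λ _ ())
  least-below (suc b) with least-below b
  ... | inj₁ l = inj₁ l
  ... | inj₂ none with P? b
  ...   | yes p  = inj₁ record { index = b ; holds = p ; below = none }
  ...   | no  ¬p = inj₂ λ i i<1+b → [ none i , (λ { refl → ¬p }) ] (m<1+n⇒m<n∨m≡n i<1+b)

  least : ∀ {k} → P k → Least P
  least {k} p with least-below (suc k)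
  ... | inj₁ l    = l
  ... | inj₂ none = contradiction p (none k (n<1+n k))

least-unique : ∀ {P Q : ℕ → Set} → (∀ i → P i → Q i) → (∀ i → Q i → P i) →
               (l : Least P) (l′ : Least Q) → index l ≡ index l′
least-unique P⇒Q Q⇒P l l′ with <-cmp (index l) (index l′)
... | tri< l<l′ _ _ = contradiction (P⇒Q _ (holds l)) (below l′ _ l<l′)
... | tri≈ _ eq _   = eq
... | tri> _ _ l′<l = contradiction (Q⇒P _ (holds l′)) (below l _ l′<l)

-- Certificates

record Certificate {l m} (X : Mat l l) (G : Mat m m) (CY : Mat l m × Mat m l) : Set where
  constructor certificate
  field
    C·G·Cᵀ≈X : gram G (proj₁ CY) ≈ₘ X
    Y·C·G≈G   : (proj₂ CY ·ₘ (proj₁ CY ·ₘ G)) ≈ₘ G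

certificate? : ∀ {l m} (X : Mat l l) (G : Mat m m) CY → Dec (Certificate X G CY)
certificate? X G (C , Y) =
  map′ (λ (p , q) → certificate p q) (λ (certificate p q) → p , q)
       (≈ₘ? (gram G C) X ×-dec ≈ₘ? (Y ·ₘ (C ·ₘ G)) G)

module _ {l m : ℕ} (X : Mat l l) where

  Certificate-respᴳ : ∀ {G G′ : Mat m m} {C Y} →
                      G ≈ₘ G′ → Certificate X G (C , Y) → Certificate X G′ (C , Y)
  Certificate-respᴳ {C = C} {Y} G≈G′ (certificate CGCᵀ≈X YCG≈G) = certificate
    (≈ₘ.trans (gram-cong (≈ₘ.sym G≈G′) ≈ₘ.refl) CGCᵀ≈X)
    (≈ₘ.trans (·ₘ-congˡ Y (·ₘ-congˡ C (≈ₘ.sym G≈G′))) (≈ₘ.trans YCG≈G G≈G′))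

  Certificate-respᶜ : ∀ {G : Mat m m} {c c′} →
                      ×-Pointwise _≈ₘ_ _≈ₘ_ c′ c → Certificate X G c → Certificate X G c′
  Certificate-respᶜ {G} (C′≈C , Y′≈Y) (certificate CGCᵀ≈X YCG≈G) = certificate
    (≈ₘ.trans (gram-cong ≈ₘ.refl C′≈C) CGCᵀ≈X)
    (≈ₘ.trans (·ₘ-cong Y′≈Y (·ₘ-congʳ G C′≈C)) YCG≈G)

  left-inverse-certificate : ∀ {E : Mat l m} {V : Mat m l} →
                             (E ·ₘ V) ≈ₘ I l → Certificate X (gram X V) (E , V)
  left-inverse-certificate {E} {V} EV≈I = certificate EGEᵀ≈X VEG≈G
    where
    open ≈ₘ-Reasoning
    EGEᵀ≈X : gram (gram X V) E ≈ₘ X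
    EGEᵀ≈X = begin
      gram (gram X V) E  ≈⟨ gram-·ₘ X E V ⟨
      gram X (E ·ₘ V)    ≈⟨ gram-cong ≈ₘ.refl EV≈I ⟩
      gram X (I l)       ≈⟨ gram-identity X ⟩
      X                  ∎
    VEG≈G : (V ·ₘ (E ·ₘ gram X V)) ≈ₘ gram X V
    VEG≈G = begin
      V ·ₘ (E ·ₘ ((V ·ₘ X) ·ₘ (V ᵀ)))  ≈⟨ ·ₘ-congˡ V (·ₘ-assoc E (V ·ₘ X) (V ᵀ)) ⟨
      V ·ₘ ((E ·ₘ (V ·ₘ X)) ·ₘ (V ᵀ))  ≈⟨ ·ₘ-congˡ V (·ₘ-congʳ (V ᵀ) (·ₘ-assoc E V X)) ⟨
      V ·ₘ (((E ·ₘ V) ·ₘ X) ·ₘ (V ᵀ))  ≈⟨ ·ₘ-congˡ V (·ₘ-congʳ (V ᵀ) (·ₘ-congʳ X EV≈I)) ⟩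
      V ·ₘ ((I l ·ₘ X) ·ₘ (V ᵀ))       ≈⟨ ·ₘ-congˡ V (·ₘ-congʳ (V ᵀ) (·ₘ-identityˡ X)) ⟩
      V ·ₘ (X ·ₘ (V ᵀ))                ≈⟨ ·ₘ-assoc V X (V ᵀ) ⟨
      gram X V                         ∎

  certificate-reconstructs : ∀ (X′ : Mat l l) → (X ·ₘ X′) ≈ₘ I l →
                             ∀ {V : Mat m l} {C Y} (E : Mat l m) → (E ·ₘ V) ≈ₘ I l →
                             Certificate X (gram X V) (C , Y) → (Y ·ₘ (C ·ₘ V)) ≈ₘ V
  certificate-reconstructs X′ XX′≈I {V} {C} {Y} E EV≈I (certificate _ YCG≈G) =
    ·ₘ-cancelʳ X′ XX′≈I (·ₘ-cancelʳ (E ᵀ) VᵀEᵀ≈I YCVXVᵀ≈VXVᵀ)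
    where
    open ≈ₘ-Reasoning
    VᵀEᵀ≈I : ((V ᵀ) ·ₘ (E ᵀ)) ≈ₘ I l
    VᵀEᵀ≈I = ≈ₘ.trans (≈ₘ.sym (·ₘ-ᵀ E V)) (≈ₘ.trans (ᵀ-cong EV≈I) (Iᵀ l))
    YCVXVᵀ≈VXVᵀ : (((Y ·ₘ (C ·ₘ V)) ·ₘ X) ·ₘ (V ᵀ)) ≈ₘ ((V ·ₘ X) ·ₘ (V ᵀ))
    YCVXVᵀ≈VXVᵀ = begin
      ((Y ·ₘ (C ·ₘ V)) ·ₘ X) ·ₘ (V ᵀ)  ≈⟨ ·ₘ-congʳ (V ᵀ) (·ₘ-assoc Y (C ·ₘ V) X) ⟩
      (Y ·ₘ ((C ·ₘ V) ·ₘ X)) ·ₘ (V ᵀ)  ≈⟨ ·ₘ-assoc Y ((C ·ₘ V) ·ₘ X) (V ᵀ) ⟩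
      Y ·ₘ (((C ·ₘ V) ·ₘ X) ·ₘ (V ᵀ))  ≈⟨ ·ₘ-congˡ Y (·ₘ-congʳ (V ᵀ) (·ₘ-assoc C V X)) ⟩
      Y ·ₘ ((C ·ₘ (V ·ₘ X)) ·ₘ (V ᵀ))  ≈⟨ ·ₘ-congˡ Y (·ₘ-assoc C (V ·ₘ X) (V ᵀ)) ⟩
      Y ·ₘ (C ·ₘ gram X V)             ≈⟨ YCG≈G ⟩
      gram X V                         ∎

IsSymplecticBasis-of-gram : ∀ {n} {B : Mat (n + n) (n + n)} →
                            Generates B → gram (J n) B ≈ₘ J n → IsSymplecticBasis n B
IsSymplecticBasis-of-gram {n} generates gram≈J =
  (generates , LinIndep-of-gram (J⁻¹ n) (J·J⁻¹ n) gram≈J) ,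
  (λ a b → trans (gram≈J (a ↑ˡ n) (n ↑ʳ b)) (J-↑ˡ-↑ʳ n a b)) ,
  (λ a b → trans (gram≈J (a ↑ˡ n) (b ↑ˡ n)) (J-↑ˡ-↑ˡ n a b)) ,
  (λ a b → trans (gram≈J (n ↑ʳ a) (n ↑ʳ b)) (J-↑ʳ-↑ʳ n a b))

certificate⇒IsSymplecticBasis : ∀ {n m} {V : Mat m (n + n)} {C Y} → Generates V →
                                Certificate (J n) (gram (J n) V) (C , Y) → IsSymplecticBasis n (C ·ₘ V)
certificate⇒IsSymplecticBasis {n} {V = V} {C} {Y} generates cert@(certificate CGCᵀ≈J _) =
  IsSymplecticBasis-of-gram
    (Generates-of-factor Y (certificate-reconstructs (J n) (J⁻¹ n) (J·J⁻¹ n) E EV≈I cert) generates)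
    (≈ₘ.trans (gram-·ₘ (J n) C V) CGCᵀ≈J)
  where
  E = proj₁ (left-inverse generates)
  EV≈I = proj₂ (left-inverse generates)

module SymplecticBasis (n : ℕ) where

  candidates : ∀ m → Enumeration (Mat (n + n) m × Mat m (n + n)) (×-Pointwise _≈ₘ_ _≈ₘ_)
  candidates m = ×-enumeration (matrix-enumeration (n + n) m) (matrix-enumeration m (n + n))

  Certified : ∀ {m} → Mat m (n + n) → ℕ → Set
  Certified V k = Certificate (J n) (gram (J n) V) (enum (candidates _) k)

  first-certified : ∀ {m} (V : Mat m (n + n)) → Generates V → Least (Certified V)
  first-certified V generates with left-inverse generates
  ... | E , EV≈I with surjective (candidates _) (E , V)
  ...   | k , k≈EV = least (λ i → certificate? _ _ (enum (candidates _) i)) {k}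
                          (Certificate-respᶜ (J n) k≈EV (left-inverse-certificate (J n) {E} {V} EV≈I))

  candidate-basis : ∀ {m} → Mat m (n + n) → ℕ → Mat (n + n) (n + n)
  candidate-basis V k = proj₁ (enum (candidates _) k) ·ₘ V

  sympBas : ∀ {m} (V : Mat m (n + n)) → Generates V → Mat (n + n) (n + n)
  sympBas V generates = candidate-basis V (index (first-certified V generates))

  sympBas-symplectic : ∀ {m} (V : Mat m (n + n)) (generates : Generates V) →
                       IsSymplecticBasis n (sympBas V generates)
  sympBas-symplectic V generates =
    certificate⇒IsSymplecticBasis generates (holds (first-certified V generates))

  sympBas-⋆ : ∀ {m} (V : Mat m (n + n)) (generates : Generates V)
              (P : Mat (n + n) (n + n)) → IsSp n P → (generates⋆ : Generates (V ⋆ P)) →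
              sympBas (V ⋆ P) generates⋆ ≈ₘ (sympBas V generates ·ₘ P)
  sympBas-⋆ V generates P sp generates⋆ =
    subst (λ k → candidate-basis (V ⋆ P) k ≈ₘ (candidate-basis V k₀ ·ₘ P)) same-index (≈ₘ.sym (·ₘ-assoc C V P))
    where
    k₀ = index (first-certified V generates)
    C = proj₁ (enum (candidates _) k₀)
    same-index : k₀ ≡ index (first-certified (V ⋆ P) generates⋆)
    same-index = least-unique (λ _ → Certificate-respᴳ (J n) (≈ₘ.sym (gram-J-⋆ {n} V P sp)))
                              (λ _ → Certificate-respᴳ (J n) (gram-J-⋆ {n} V P sp))
                              (first-certified V generates) (first-certified (V ⋆ P) generates⋆)

theorem5p1p1 : (n : ℕ) →
    Σ (∀ {m} (V : Fin m → Vecℤ (n + n)) → Generates V → Fin (n + n) → Vecℤ (n + n))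
      λ SympBas →
        (∀ {m} (V : Fin m → Vecℤ (n + n)) (g : Generates V) → IsSymplecticBasis n (SympBas V g))
        × (∀ {m} (V : Fin m → Vecℤ (n + n)) (g : Generates V)
             (P : Mat (n + n) (n + n)) → IsSp n P → (gP : Generates (V ⋆ P)) →
             ∀ t → SympBas (V ⋆ P) gP t ≈ᵥ (SympBas V g t ·ᵥ P))
theorem5p1p1 n = sympBas , sympBas-symplectic , sympBas-⋆
  where open SymplecticBasis n
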